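{- Let $D$ be a connected mixed graph and $\alpha\in\mathbb{C}$ with $|\alpha|=1$. The following are equivalent: (i) $s^\alpha(u)=1$ for at least one $u\in V(D)$; (ii) $s^\alpha(u)=1$ for every $u\in V(D)$; (iii) $h_\alpha(W')=h_\alpha(W'')$ for every pair $W',W''$ of mixed walks having the same start vertex and the same end vertex; (iv) $D$ is an $\alpha$-monograph of first kind.
   Context: A mixed graph $D$ is obtained from a finite simple undirected graph $\Gamma(D)$ by replacing some edges by arcs: between any two adjacent vertices $u,v$ there is exactly one of a digon $u\sim v$, an arc $u\to v$, or an arc $v\to u$; connectedness and cycles refer to $\Gamma(D)$. For $|\alpha|=1$ set $h_{uv}=1$ if $u\sim v$, $\alpha$ if $u\to v$, $\bar\alpha$ if $v\to u$. A mixed walk $W=v_1,\dots,v_k$ (consecutive vertices adjacent) has value $h_\alpha(W)=h_{v_1v_2}\cdots h_{v_{k-1}v_k}$ (equal to $1$ if $k=1$). The $\alpha$-store of $u$ is $S^\alpha(u)=\{h_\alpha(W): W$ a closed mixed walk starting and ending at $u\}$ and $s^\alpha(u)=|S^\alpha(u)|$. For a cycle $C$ with vertices $v_1,\dots,v_\ell$ in cyclic order, a traversal $\vec C$ is the closed walk $v_1,\dots,v_\ell,v_1$ (either direction, any start). $D$ is an $\alpha$-monograph of first kind if $h_\alpha(\vec C)=1$ for every cycle $C$ and every traversal $\vec C$. -}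

module Defs where

open import Level using (Level; _⊔_)
open import Data.Nat using (ℕ; _≤_)
open import Data.Fin using (Fin)
open import Data.List using (List; []; _∷_; _++_; length)
open import Data.List.Relation.Unary.Linked using (Linked)
open import Data.List.Relation.Unary.Unique.Propositional using (Unique)
open import Data.Product using (Σ; ∃; _×_)
open import Relation.Binary.PropositionalEquality using (_≡_; _≢_)
open import Algebra.Bundles using (AbelianGroup)

-- Kind of the (ordered) pair (u , v) in a mixed graph.
data EdgeKind : Set where
  noEdge  : EdgeKind
  digon   : EdgeKind
  arcTo   : EdgeKind   -- u → v
  arcFrom : EdgeKind   -- v → u

flipKind : EdgeKind → EdgeKind
flipKind noEdge  = noEdge
flipKind digon   = digon
flipKind arcTo   = arcFrom
flipKind arcFrom = arcTo

record MixedGraph : Set where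
  field
    n        : ℕ
    kind     : Fin n → Fin n → EdgeKind
    loopless : ∀ u → kind u u ≡ noEdge
    symm     : ∀ u v → kind v u ≡ flipKind (kind u v)

module _ (D : MixedGraph) where
  open MixedGraph D

  V : Set
  V = Fin n

  Adjacent : V → V → Set
  Adjacent u v = kind u v ≢ noEdge

  data Walk : V → V → Set where
    [_]  : (u : V) → Walk u u
    step : (u : V) {v w : V} → Adjacent u v → Walk v w → Walk u w

  -- connectedness (of the underlying graph Γ(D)); a connected graph is
  -- nonempty by the usual convention
  Connected : Set
  Connected = (1 ≤ n) × (∀ u v → Walk u v)

  -- cycles given by their vertex list v₁ … v_ℓ (in cyclic order): every
  -- traversal of a cycle is again such a list (rotation / reversal)
  IsCycleList : V → List V → Set
  IsCycleList v rest =
    (2 ≤ length rest) × Unique (v ∷ rest) × Linked Adjacent (v ∷ rest ++ v ∷ [])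

  module _ {c ℓ : Level} (G : AbelianGroup c ℓ) (α : AbelianGroup.Carrier G) where
    open AbelianGroup G

    -- h_{uv} ; conjugation of the unit α is its inverse
    h : V → V → Carrier
    h u v with kind u v
    ... | noEdge  = ε
    ... | digon   = ε
    ... | arcTo   = α
    ... | arcFrom = α ⁻¹

    hW : {u v : V} → Walk u v → Carrier
    hW [ u ]                 = ε
    hW (step u {v} _ W)      = h u v ∙ hW W

    hList : List V → Carrier
    hList (x ∷ y ∷ t) = h x y ∙ hList (y ∷ t)
    hList _           = ε

    -- s^α(u) = 1 : the store {h_α(W) : W closed walk at u} has exactly one element
    StoreSizeOne : V → Set (c ⊔ ℓ)
    StoreSizeOne u =
      Σ Carrier λ x → (∀ (W : Walk u u) → hW W ≈ x) × ∃ λ (W : Walk u u) → hW W ≈ x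

    MonographFirstKind : Set ℓ
    MonographFirstKind =
      ∀ v rest → IsCycleList v rest → hList (v ∷ rest ++ v ∷ []) ≈ ε

    WalkValueIndependent : Set ℓ
    WalkValueIndependent = ∀ u v (W′ W″ : Walk u v) → hW W′ ≈ hW W″

-- Loop erasure turns a walk into a path with the same ends; every loop it
-- cuts out is a cycle, or a step along an edge and straight back (value
-- α α⁻¹ = 1), so if all cycles have value 1 the value of a walk is unchanged
-- and a closed walk, whose loop-erased path is trivial, has value 1.  Two walks
-- u → v are compared through the closed walk W′ followed by W″ reversed, and a
-- closed walk at u is carried to any vertex v by conjugating it with a walk
-- u → v, which does not change its value in an abelian group.
module Submission where

open import Defs
open import Level using (Level)
open import Data.Product using (Σ; _×_; _,_)
open import Algebra.Bundles using (AbelianGroup)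
open import Function.Bundles using (_⇔_; mk⇔; Equivalence)
open import Data.Nat using (s≤s; z≤n)
open import Data.Fin using (fromℕ<; _≟_)
open import Data.List using (List; []; _∷_; _++_)
open import Data.List.Relation.Unary.Linked using (Linked; [-]; _∷_)
open import Data.List.Relation.Unary.AllPairs using ([]; _∷_)
open import Data.List.Relation.Unary.All using ([]; _∷_)
open import Data.List.Relation.Unary.All.Properties using (¬Any⇒All¬; ++⁻ˡ; ++⁻ʳ)
open import Data.List.Relation.Unary.Any using (here; there)
open import Data.List.Relation.Unary.Unique.Propositional using (Unique)
open import Data.List.Membership.Propositional using (_∈_)
open import Data.Empty using (⊥-elim)
open import Relation.Nullary using (¬_; yes; no)
open import Relation.Binary.PropositionalEquality as ≡ using (_≡_; cong; subst)

unique-suffix : ∀ {a} {A : Set a} (xs : List A) {ys : List A} → Unique (xs ++ ys) → Unique ys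
unique-suffix []       u       = u
unique-suffix (_ ∷ xs) (_ ∷ u) = unique-suffix xs u

unique-rotate : ∀ {a} {A : Set a} (xs : List A) {y : A} {ys : List A} →
  Unique (xs ++ y ∷ ys) → Unique (y ∷ xs)
unique-rotate []       _ = [] ∷ []
unique-rotate (x ∷ xs) (x∉ ∷ u) with unique-rotate xs u | ++⁻ʳ xs x∉
... | y∉xs ∷ uxs | x≢y ∷ _ = ((λ y≡x → x≢y (≡.sym y≡x)) ∷ y∉xs) ∷ ++⁻ˡ xs x∉ ∷ uxs

module Walks (D : MixedGraph) where
  open MixedGraph D

  flipKind-noEdge : ∀ k → flipKind k ≡ noEdge → k ≡ noEdge
  flipKind-noEdge noEdge _ = ≡.refl

  Adjacent-sym : ∀ {u v} → Adjacent D u v → Adjacent D v u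
  Adjacent-sym {u} {v} u~v v≁u = u~v (flipKind-noEdge (kind u v) (≡.trans (≡.sym (symm u v)) v≁u))

  ¬Adjacent-refl : ∀ u → ¬ Adjacent D u u
  ¬Adjacent-refl u u~u = u~u (loopless u)

  _++ʷ_ : ∀ {u v w} → Walk D u v → Walk D v w → Walk D u w
  [ _ ]      ++ʷ R = R
  step u a Q ++ʷ R = step u a (Q ++ʷ R)

  reverse : ∀ {u v} → Walk D u v → Walk D v u
  reverse [ u ]            = [ u ]
  reverse (step u {v} a W) = reverse W ++ʷ step v (Adjacent-sym a) [ u ]

  tailVertices : ∀ {u v} → Walk D u v → List (V D)
  tailVertices [ _ ]            = []
  tailVertices (step _ {v} _ W) = v ∷ tailVertices W

  vertices : ∀ {u v} → Walk D u v → List (V D)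
  vertices {u} W = u ∷ tailVertices W

  support : ∀ {u v} → Walk D u v → List (V D)
  support [ _ ]        = []
  support (step u _ W) = u ∷ support W

  vertices≡support++end : ∀ {u v} (W : Walk D u v) → vertices W ≡ support W ++ v ∷ []
  vertices≡support++end [ _ ]        = ≡.refl
  vertices≡support++end (step u _ W) = cong (u ∷_) (vertices≡support++end W)

  vertices-++ʷ : ∀ {u v w} (Q : Walk D u v) (R : Walk D v w) →
    vertices (Q ++ʷ R) ≡ support Q ++ vertices R
  vertices-++ʷ [ _ ]        R = ≡.refl
  vertices-++ʷ (step u _ Q) R = cong (u ∷_) (vertices-++ʷ Q R)

  vertices-linked : ∀ {u v} (W : Walk D u v) → Linked (Adjacent D) (vertices W)
  vertices-linked [ _ ]        = [-]
  vertices-linked (step _ a W) = a ∷ vertices-linked W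

  splitAt : ∀ {u v w} (P : Walk D v w) → u ∈ vertices P →
    Σ (Walk D v u) λ Q → Σ (Walk D u w) λ R → P ≡ Q ++ʷ R
  splitAt [ v ]        (here ≡.refl) = [ v ] , [ v ] , ≡.refl
  splitAt (step v a P) (here ≡.refl) = [ v ] , step v a P , ≡.refl
  splitAt (step v a P) (there u∈P) with splitAt P u∈P
  ... | Q , R , P≡Q++R = step v a Q , R , cong (step v a) P≡Q++R

  walkAlong : ∀ x t y → Linked (Adjacent D) (x ∷ t ++ y ∷ []) →
    Σ (Walk D x y) λ W → vertices W ≡ x ∷ t ++ y ∷ []
  walkAlong x []      y (a ∷ [-]) = step x a [ y ] , ≡.refl
  walkAlong x (z ∷ t) y (a ∷ l) with walkAlong z t y l
  ... | W , vertices≡ = step x a W , cong (x ∷_) vertices≡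

module WalkValues {c ℓ : Level} (G : AbelianGroup c ℓ) (α : AbelianGroup.Carrier G) (D : MixedGraph) where
  open MixedGraph D
  open Walks D
  open AbelianGroup G
  open import Algebra.Properties.Group group using (ε⁻¹≈ε; ⁻¹-involutive; x∙y⁻¹≈ε⇒x≈y)
  open import Algebra.Properties.AbelianGroup G using (⁻¹-∙-comm; xyx⁻¹≈y)
  open import Relation.Binary.Reasoning.Setoid setoid
  open import Data.List.Membership.DecPropositional {A = V D} _≟_ using (_∈?_)

  private
    hα : V D → V D → Carrier
    hα = h D G α

    ⟦_⟧ : ∀ {u v} → Walk D u v → Carrier
    ⟦_⟧ = hW D G α

  h-flip : ∀ u v → hα v u ≈ hα u v ⁻¹
  h-flip u v rewrite symm u v with kind u v
  ... | noEdge  = sym ε⁻¹≈ε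
  ... | digon   = sym ε⁻¹≈ε
  ... | arcTo   = refl
  ... | arcFrom = sym (⁻¹-involutive α)

  hW-++ʷ : ∀ {u v w} (Q : Walk D u v) (R : Walk D v w) → ⟦ Q ++ʷ R ⟧ ≈ ⟦ Q ⟧ ∙ ⟦ R ⟧
  hW-++ʷ [ _ ]            R = sym (identityˡ _)
  hW-++ʷ (step u {v} _ Q) R = begin
    hα u v ∙ ⟦ Q ++ʷ R ⟧     ≈⟨ ∙-congˡ (hW-++ʷ Q R) ⟩
    hα u v ∙ (⟦ Q ⟧ ∙ ⟦ R ⟧) ≈⟨ sym (assoc _ _ _) ⟩
    (hα u v ∙ ⟦ Q ⟧) ∙ ⟦ R ⟧ ∎

  hW-reverse : ∀ {u v} (W : Walk D u v) → ⟦ reverse W ⟧ ≈ ⟦ W ⟧ ⁻¹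
  hW-reverse [ _ ]            = sym ε⁻¹≈ε
  hW-reverse (step u {v} a W) = begin
    ⟦ reverse W ++ʷ step v (Adjacent-sym a) [ u ] ⟧ ≈⟨ hW-++ʷ (reverse W) _ ⟩
    ⟦ reverse W ⟧ ∙ (hα v u ∙ ε)                   ≈⟨ ∙-cong (hW-reverse W) (identityʳ _) ⟩
    ⟦ W ⟧ ⁻¹ ∙ hα v u                               ≈⟨ ∙-congˡ (h-flip u v) ⟩
    ⟦ W ⟧ ⁻¹ ∙ hα u v ⁻¹                            ≈⟨ ⁻¹-∙-comm _ _ ⟩
    (⟦ W ⟧ ∙ hα u v) ⁻¹                             ≈⟨ ⁻¹-cong (comm _ _) ⟩
    (hα u v ∙ ⟦ W ⟧) ⁻¹                             ∎

  hW-conjugate : ∀ {u v} (P : Walk D u v) (C : Walk D v v) → ⟦ P ++ʷ (C ++ʷ reverse P) ⟧ ≈ ⟦ C ⟧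
  hW-conjugate P C = begin
    ⟦ P ++ʷ (C ++ʷ reverse P) ⟧        ≈⟨ hW-++ʷ P _ ⟩
    ⟦ P ⟧ ∙ ⟦ C ++ʷ reverse P ⟧        ≈⟨ ∙-congˡ (hW-++ʷ C (reverse P)) ⟩
    ⟦ P ⟧ ∙ (⟦ C ⟧ ∙ ⟦ reverse P ⟧)    ≈⟨ ∙-congˡ (∙-congˡ (hW-reverse P)) ⟩
    ⟦ P ⟧ ∙ (⟦ C ⟧ ∙ ⟦ P ⟧ ⁻¹)         ≈⟨ sym (assoc _ _ _) ⟩
    ⟦ P ⟧ ∙ ⟦ C ⟧ ∙ ⟦ P ⟧ ⁻¹           ≈⟨ xyx⁻¹≈y _ _ ⟩
    ⟦ C ⟧                               ∎

  hList-vertices : ∀ {u v} (W : Walk D u v) → hList D G α (vertices W) ≈ ⟦ W ⟧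
  hList-vertices [ _ ]        = refl
  hList-vertices (step _ _ W) = ∙-congˡ (hList-vertices W)

  ClosedWalksTrivial : V D → Set _
  ClosedWalksTrivial u = ∀ (C : Walk D u u) → ⟦ C ⟧ ≈ ε

  storeSizeOne⇔closedWalksTrivial : ∀ u → StoreSizeOne D G α u ⇔ ClosedWalksTrivial u
  storeSizeOne⇔closedWalksTrivial u = mk⇔
    (λ (x , ≈x , _) C → trans (≈x C) (sym (≈x [ u ])))
    (λ trivial → ε , trivial , [ u ] , refl)

  closedWalksTrivial-transport : ∀ {u v} → Walk D u v → ClosedWalksTrivial u → ClosedWalksTrivial v
  closedWalksTrivial-transport P trivial C = trans (sym (hW-conjugate P C)) (trivial (P ++ʷ (C ++ʷ reverse P)))

  closedWalksTrivial⇒walkValueIndependent : (∀ u → ClosedWalksTrivial u) → WalkValueIndependent D G α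
  closedWalksTrivial⇒walkValueIndependent trivial u v W′ W″ = x∙y⁻¹≈ε⇒x≈y _ _ (begin
    ⟦ W′ ⟧ ∙ ⟦ W″ ⟧ ⁻¹             ≈⟨ ∙-congˡ (sym (hW-reverse W″)) ⟩
    ⟦ W′ ⟧ ∙ ⟦ reverse W″ ⟧        ≈⟨ sym (hW-++ʷ W′ (reverse W″)) ⟩
    ⟦ W′ ++ʷ reverse W″ ⟧          ≈⟨ trivial u (W′ ++ʷ reverse W″) ⟩
    ε                              ∎)

  walkValueIndependent⇒closedWalksTrivial : WalkValueIndependent D G α → ∀ u → ClosedWalksTrivial u
  walkValueIndependent⇒closedWalksTrivial independent u C = independent u u C [ u ]

  walkValueIndependent⇒monographFirstKind : WalkValueIndependent D G α → MonographFirstKind D G α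
  walkValueIndependent⇒monographFirstKind independent v rest (_ , _ , linked)
    with walkAlong v rest v linked
  ... | W , vertices≡ = begin
    hList D G α (v ∷ rest ++ v ∷ []) ≡⟨ cong (hList D G α) vertices≡ ⟨
    hList D G α (vertices W)         ≈⟨ hList-vertices W ⟩
    ⟦ W ⟧                            ≈⟨ independent v v W [ v ] ⟩
    ε                                ∎

  module _ (monograph : MonographFirstKind D G α) where

    hW-cycle : ∀ {u} (C : Walk D u u) → Unique (support C) → ⟦ C ⟧ ≈ ε
    hW-cycle [ _ ]                           _ = refl
    hW-cycle (step u a [ _ ])                _ = ⊥-elim (¬Adjacent-refl u a)
    hW-cycle (step u {v} _ (step _ _ [ _ ])) _ = begin
      hα u v ∙ (hα v u ∙ ε) ≈⟨ ∙-congˡ (trans (identityʳ _) (h-flip u v)) ⟩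
      hα u v ∙ hα u v ⁻¹    ≈⟨ inverseʳ _ ⟩
      ε                     ∎
    hW-cycle C@(step u _ (step _ _ (step _ _ _))) unique = begin
      ⟦ C ⟧                             ≈⟨ hList-vertices C ⟨
      hList D G α (vertices C)          ≡⟨ cong (hList D G α) (vertices≡support++end C) ⟩
      hList D G α (support C ++ u ∷ []) ≈⟨ monograph u _ (s≤s (s≤s z≤n) , unique , linked) ⟩
      ε                                 ∎
      where
      linked : Linked (Adjacent D) (support C ++ u ∷ [])
      linked = subst (Linked (Adjacent D)) (vertices≡support++end C) (vertices-linked C)

    eraseLoops : ∀ {u w} (W : Walk D u w) → Σ (Walk D u w) λ P → Unique (vertices P) × ⟦ P ⟧ ≈ ⟦ W ⟧
    eraseLoops [ u ] = [ u ] , [] ∷ [] , refl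
    eraseLoops (step u {v} a W) with eraseLoops W
    ... | P , unique , P≈W with u ∈? vertices P
    ... | no u∉P = step u a P , ¬Any⇒All¬ _ u∉P ∷ unique , ∙-congˡ P≈W
    ... | yes u∈P with splitAt P u∈P
    ... | Q , R , ≡.refl = R , unique-suffix (support Q) uniqueQR , (begin
      ⟦ R ⟧                    ≈⟨ identityˡ _ ⟨
      ε ∙ ⟦ R ⟧                ≈⟨ ∙-congʳ (hW-cycle (step u a Q) (unique-rotate (support Q) uniqueQR)) ⟨
      ⟦ step u a Q ⟧ ∙ ⟦ R ⟧   ≈⟨ assoc _ _ _ ⟩
      hα u v ∙ (⟦ Q ⟧ ∙ ⟦ R ⟧) ≈⟨ ∙-congˡ (hW-++ʷ Q R) ⟨
      hα u v ∙ ⟦ Q ++ʷ R ⟧     ≈⟨ ∙-congˡ P≈W ⟩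
      hα u v ∙ ⟦ W ⟧           ∎)
      where
      uniqueQR : Unique (support Q ++ vertices R)
      uniqueQR = subst Unique (vertices-++ʷ Q R) unique

    monographFirstKind⇒closedWalksTrivial : ∀ u → ClosedWalksTrivial u
    monographFirstKind⇒closedWalksTrivial u C with eraseLoops C
    ... | P , unique , P≈C = trans (sym P≈C) (hW-cycle P uniqueSupport)
      where
      uniqueSupport : Unique (support P)
      uniqueSupport with unique-rotate (support P) (subst Unique (vertices≡support++end P) unique)
      ... | _ ∷ uniqueTail = uniqueTail

theorem5p7 : {c ℓ : Level} (G : AbelianGroup c ℓ) (α : AbelianGroup.Carrier G) (D : MixedGraph) →
    Connected D →
      ((Σ (V D) λ u → StoreSizeOne D G α u) ⇔ (∀ u → StoreSizeOne D G α u))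
      × ((∀ u → StoreSizeOne D G α u) ⇔ WalkValueIndependent D G α)
      × (WalkValueIndependent D G α ⇔ MonographFirstKind D G α)
theorem5p7 G α D (nonempty , connected) =
  mk⇔ (λ (u , store) v → fromTrivial (closedWalksTrivial-transport (connected u v) (toTrivial store)))
      (λ stores → fromℕ< nonempty , stores _)
  , mk⇔ (λ stores → closedWalksTrivial⇒walkValueIndependent (λ u → toTrivial (stores u)))
        (λ independent u → fromTrivial (walkValueIndependent⇒closedWalksTrivial independent u))
  , mk⇔ walkValueIndependent⇒monographFirstKind
        (λ monograph → closedWalksTrivial⇒walkValueIndependent (monographFirstKind⇒closedWalksTrivial monograph))
  where
  open WalkValues G α D
  toTrivial : ∀ {u} → StoreSizeOne D G α u → ClosedWalksTrivial u
  toTrivial = Equivalence.to (storeSizeOne⇔closedWalksTrivial _)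
  fromTrivial : ∀ {u} → ClosedWalksTrivial u → StoreSizeOne D G α u
  fromTrivial = Equivalence.from (storeSizeOne⇔closedWalksTrivial _)
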